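{- Let $P_0,P_1$ be finite posets, $q_0\in P_0$, $q_1\in P_1$, and let $P=P_0\,{}_{q_0}\#_{q_1}P_1$ be the connected sum along the one-point poset $Q=\{*\}$ with $i_k(*)=q_k$. Then \[ \mu_P(x,y)=\begin{cases}\mu_k(x,y) & \text{if } x,y\in P_k,\ k=0,1,\\ -\delta_{q_0}(x)\delta_{q_1}(y) & \text{if } x\in P_0,\ y\in P_1,\\ 0 & \text{if } x\in P_1,\ y\in P_0,\end{cases} \] where $\delta_a(b)=1$ if $a=b$ and $0$ otherwise.
   Context: For a finite poset $R$, its Möbius function $\mu_R$ is defined by $\mu_R(x,x)=1$, $\mu_R(x,y)=0$ unless $x\le y$, and $\sum_{x\le z\le y}\mu_R(x,z)=0$ for $x<y$; $\mu_k=\mu_{P_k}$. The connected sum $P_0\,{}_{q_0}\#_{q_1}P_1$ is the disjoint union $P_0\sqcup P_1$ with the partial order $\preceq$: $x\preceq y$ iff either $x,y$ lie in the same $P_k$ and $x\le_ky$, or $x\in P_0$, $y\in P_1$, $x\le_0q_0$ and $q_1\le_1y$. -}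

module Defs where

open import Level using (0ℓ)
open import Data.Nat using (ℕ; zero; suc; _+_)
open import Data.Fin using (Fin; splitAt; _↑ˡ_; _↑ʳ_; _≟_)
import Data.Fin as F
open import Data.Integer using (ℤ; 0ℤ; 1ℤ)
import Data.Integer as ℤ
open import Data.Sum using (_⊎_; inj₁; inj₂)
open import Data.Product using (_×_; _,_)
open import Data.Empty using (⊥)
open import Data.Bool using (Bool; true; false; if_then_else_; _∧_)
open import Relation.Nullary using (¬_; Dec; yes; no; does)
open import Relation.Nullary.Decidable using (_×-dec_)
open import Relation.Binary using (Rel; Decidable; IsPartialOrder)
open import Relation.Binary.PropositionalEquality using (_≡_; _≢_)

record FinPoset (n : ℕ) : Set₁ where
  field
    _≤_            : Rel (Fin n) 0ℓ
    isPartialOrder : IsPartialOrder _≡_ _≤_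
    _≤?_           : Decidable _≤_

ΣFin : (n : ℕ) → (Fin n → ℤ) → ℤ
ΣFin zero    f = 0ℤ
ΣFin (suc n) f = f F.zero ℤ.+ ΣFin n (λ i → f (F.suc i))

IsMöbius : {n : ℕ} (_≤_ : Rel (Fin n) 0ℓ) → Decidable _≤_ → (Fin n → Fin n → ℤ) → Set
IsMöbius {n} _≤_ _≤?_ μ =
  (∀ x → μ x x ≡ 1ℤ)
  × (∀ x y → ¬ (x ≤ y) → μ x y ≡ 0ℤ)
  × (∀ x y → x ≤ y → x ≢ y →
       ΣFin n (λ z → if does (x ≤? z) ∧ does (z ≤? y) then μ x z else 0ℤ) ≡ 0ℤ)

IsMöbiusOf : {n : ℕ} → FinPoset n → (Fin n → Fin n → ℤ) → Set
IsMöbiusOf P μ = IsMöbius (FinPoset._≤_ P) (FinPoset._≤?_ P) μ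

-- Connected sum P₀ _{q₀}#_{q₁} P₁ with carrier Fin (n₀ + n₁):
-- elements x ↑ˡ n₁ come from P₀, elements n₀ ↑ʳ y come from P₁.
module ConnectedSum {n₀ n₁ : ℕ} (P₀ : FinPoset n₀) (P₁ : FinPoset n₁)
                    (q₀ : Fin n₀) (q₁ : Fin n₁) where
  open FinPoset P₀ renaming (_≤_ to _≤₀_; _≤?_ to _≤₀?_) using ()
  open FinPoset P₁ renaming (_≤_ to _≤₁_; _≤?_ to _≤₁?_) using ()

  _≼⊎_ : Fin n₀ ⊎ Fin n₁ → Fin n₀ ⊎ Fin n₁ → Set
  inj₁ x ≼⊎ inj₁ y = x ≤₀ y
  inj₂ x ≼⊎ inj₂ y = x ≤₁ y
  inj₁ x ≼⊎ inj₂ y = (x ≤₀ q₀) × (q₁ ≤₁ y)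
  inj₂ x ≼⊎ inj₁ y = ⊥

  _≼⊎?_ : (a b : Fin n₀ ⊎ Fin n₁) → Dec (a ≼⊎ b)
  inj₁ x ≼⊎? inj₁ y = x ≤₀? y
  inj₂ x ≼⊎? inj₂ y = x ≤₁? y
  inj₁ x ≼⊎? inj₂ y = (x ≤₀? q₀) ×-dec (q₁ ≤₁? y)
  inj₂ x ≼⊎? inj₁ y = no (λ ())

  _≼_ : Rel (Fin (n₀ + n₁)) 0ℓ
  a ≼ b = splitAt n₀ a ≼⊎ splitAt n₀ b

  _≼?_ : Decidable _≼_
  a ≼? b = splitAt n₀ a ≼⊎? splitAt n₀ b

δ : {n : ℕ} → Fin n → Fin n → ℤ
δ a b = if does (a ≟ b) then 1ℤ else 0ℤ

module Submission where

-- Write ι₀, ι₁ for the inclusions of P₀ and P₁ into P.  Everything rests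
-- on a uniqueness principle on a finite poset: a function f on the
-- elements is determined by its values off the up-set of x together with
-- the interval sums Σ_{x ≤ z ≤ y} f(z) for y ≥ x (well-founded induction
-- on y along the strict order).  Hence Möbius functions are unique, and
-- their rows satisfy Σ_{x ≤ z ≤ y} μ(x,z) = δ(x,y).
--
-- In P an interval between two points of the same P_k is an interval of
-- P_k, and [ι₀ x, ι₁ y] is the disjoint union of [x,q₀] and [q₁,y].  So
-- μ_P restricted to P_k is a Möbius function of P_k, hence equals μ_k;
-- μ_P(ι₁ x, ι₀ y) = 0 since ι₁ x ⋠ ι₀ y; and for x ≤ q₀ the row
-- c ↦ μ_P(ι₀ x, ι₁ c) has interval sum −δ(q₀,x) on every [q₁,y], as does
-- c ↦ −δ(q₀,x)·δ(q₁,c), so the two coincide by uniqueness.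

open import Defs
open import Level using (0ℓ)
open import Data.Nat using (ℕ; zero; suc; _+_)
open import Data.Fin using (Fin; _↑ˡ_; _↑ʳ_; splitAt)
import Data.Fin as F
open import Data.Fin.Properties using (splitAt-↑ˡ; splitAt-↑ʳ; ↑ˡ-injective; ↑ʳ-injective; suc-injective)
open import Data.Fin.Induction using (po-wellFounded)
open import Data.Integer using (ℤ; 0ℤ; 1ℤ; -_; _*_) renaming (_+_ to _⊕_)
import Data.Integer.Properties as ℤP
open import Algebra.Bundles using (AbelianGroup)
import Algebra.Properties.Group as GroupProperties
import Algebra.Properties.Quasigroup as QuasigroupProperties
open import Data.Product using (_×_; _,_; proj₁; proj₂)
open import Data.Sum using (inj₁; inj₂)
open import Data.Bool using (Bool; false; if_then_else_; _∧_)
open import Data.Bool.Properties using (∧-zeroʳ; ∧-identityʳ)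
open import Data.Empty using (⊥-elim)
open import Function using (_∘_; id)
open import Function.Bundles using (_⇔_; mk⇔; Equivalence)
open import Induction.WellFounded using (WellFounded; Acc; acc)
open import Relation.Nullary using (¬_; yes; no; does)
open import Relation.Nullary.Decidable using (dec-true; dec-false)
open import Relation.Binary using (Rel; Decidable; IsPartialOrder)
import Relation.Binary.Construct.NonStrictToStrict as ToStrict
open import Relation.Binary.PropositionalEquality using (_≡_; _≢_; refl; sym; trans; cong; cong₂; module ≡-Reasoning)

open Equivalence using (to; from)

open GroupProperties (AbelianGroup.group ℤP.+-0-abelianGroup) using (inverseʳ-unique; quasigroup)
open QuasigroupProperties quasigroup using (cancelˡ; cancelʳ)

Σ-cong : ∀ n {f g : Fin n → ℤ} → (∀ i → f i ≡ g i) → ΣFin n f ≡ ΣFin n g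
Σ-cong zero    _ = refl
Σ-cong (suc n) f≗g = cong₂ _⊕_ (f≗g F.zero) (Σ-cong n (f≗g ∘ F.suc))

Σ-zero : ∀ n {f : Fin n → ℤ} → (∀ i → f i ≡ 0ℤ) → ΣFin n f ≡ 0ℤ
Σ-zero zero    _ = refl
Σ-zero (suc n) f≗0 = cong₂ _⊕_ (f≗0 F.zero) (Σ-zero n (f≗0 ∘ F.suc))

Σ-point : ∀ n (f : Fin n → ℤ) j → (∀ i → i ≢ j → f i ≡ 0ℤ) → ΣFin n f ≡ f j
Σ-point (suc n) f F.zero    vanish =
  trans (cong (f F.zero ⊕_) (Σ-zero n (λ i → vanish (F.suc i) (λ ())))) (ℤP.+-identityʳ _)
Σ-point (suc n) f (F.suc j) vanish =
  trans (cong₂ _⊕_ (vanish F.zero (λ ()))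
                   (Σ-point n (f ∘ F.suc) j (λ i i≢j → vanish (F.suc i) (i≢j ∘ suc-injective))))
        (ℤP.+-identityˡ _)

Σ-agree-at : ∀ n (f g : Fin n → ℤ) j → (∀ i → i ≢ j → f i ≡ g i) → ΣFin n f ≡ ΣFin n g → f j ≡ g j
Σ-agree-at (suc n) f g F.zero    agree eq =
  cancelʳ _ _ _ (trans eq (cong (g F.zero ⊕_) (sym (Σ-cong n (λ i → agree (F.suc i) (λ ()))))))
Σ-agree-at (suc n) f g (F.suc j) agree eq =
  Σ-agree-at n (f ∘ F.suc) (g ∘ F.suc) j (λ i i≢j → agree (F.suc i) (i≢j ∘ suc-injective))
    (cancelˡ (g F.zero) _ _ (trans (cong (_⊕ ΣFin n (f ∘ F.suc)) (sym (agree F.zero (λ ())))) eq))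

Σ-split : ∀ m n (f : Fin (m + n) → ℤ) →
          ΣFin (m + n) f ≡ ΣFin m (λ i → f (i ↑ˡ n)) ⊕ ΣFin n (λ j → f (m ↑ʳ j))
Σ-split zero    n f = sym (ℤP.+-identityˡ _)
Σ-split (suc m) n f =
  trans (cong (f F.zero ⊕_) (Σ-split m n (f ∘ F.suc))) (sym (ℤP.+-assoc (f F.zero) _ _))

guard : Bool → ℤ → ℤ
guard c v = if c then v else 0ℤ

guard-cong : ∀ {c d} v → c ≡ d → guard c v ≡ guard d v
guard-cong v = cong (λ c → guard c v)

δ-self : ∀ {n} (a : Fin n) → δ a a ≡ 1ℤ
δ-self a = guard-cong 1ℤ (dec-true (a F.≟ a) refl)

δ-off : ∀ {n} {a b : Fin n} → a ≢ b → δ a b ≡ 0ℤ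
δ-off {a = a} {b} a≢b = guard-cong 1ℤ (dec-false (a F.≟ b) a≢b)

δ-sym : ∀ {n} (a b : Fin n) → δ a b ≡ δ b a
δ-sym a b with a F.≟ b | b F.≟ a
... | yes _   | yes _   = refl
... | no _    | no _    = refl
... | yes a≡b | no b≢a  = ⊥-elim (b≢a (sym a≡b))
... | no a≢b  | yes b≡a = ⊥-elim (a≢b (sym b≡a))

-- Interval sums Σ_{x ≤ z ≤ y} f(z) for any decidable relation on Fin n;
-- the last clause of IsMöbius is literally intervalSum x y (μ x) ≡ 0.
module Intervals {n : ℕ} {_≤_ : Rel (Fin n) 0ℓ} (_≤?_ : Decidable _≤_) where

  intervalSum : Fin n → Fin n → (Fin n → ℤ) → ℤ
  intervalSum x y f = ΣFin n (λ z → guard (does (x ≤? z) ∧ does (z ≤? y)) (f z))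

  intervalSum-cong : ∀ x y {f g : Fin n → ℤ} → (∀ z → f z ≡ g z) → intervalSum x y f ≡ intervalSum x y g
  intervalSum-cong x y f≗g = Σ-cong n (λ z → cong (guard _) (f≗g z))

module PosetMöbius {n : ℕ} (P : FinPoset n) where
  open FinPoset P
  open IsPartialOrder isPartialOrder using () renaming (refl to ≤-refl; antisym to ≤-antisym)
  open Intervals _≤?_ public

  intervalSum-concentrated : ∀ {x y} (f : Fin n → ℤ) → x ≤ y →
    (∀ z → x ≤ z → z ≤ y → z ≢ x → f z ≡ 0ℤ) → intervalSum x y f ≡ f x
  intervalSum-concentrated {x} {y} f x≤y vanish =
    trans (Σ-point n _ x outside)
          (guard-cong (f x) (cong₂ _∧_ (dec-true (x ≤? x) ≤-refl) (dec-true (x ≤? y) x≤y)))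
    where
    outside : ∀ z → z ≢ x → guard (does (x ≤? z) ∧ does (z ≤? y)) (f z) ≡ 0ℤ
    outside z z≢x with x ≤? z | z ≤? y
    ... | yes x≤z | yes z≤y = vanish z x≤z z≤y z≢x
    ... | yes _   | no _    = refl
    ... | no _    | _       = refl

  intervalSum-singleton : ∀ x (f : Fin n → ℤ) → intervalSum x x f ≡ f x
  intervalSum-singleton x f =
    intervalSum-concentrated f ≤-refl (λ z x≤z z≤x z≢x → ⊥-elim (z≢x (≤-antisym z≤x x≤z)))

  _<_ : Rel (Fin n) 0ℓ
  _<_ = ToStrict._<_ _≡_ _≤_

  <-wellFounded : WellFounded _<_
  <-wellFounded = po-wellFounded isPartialOrder

  -- Induction along _<_: the
  -- sum over [x,y] determines the top term once the lower ones are known.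
  upset-determined : ∀ x (f g : Fin n → ℤ) →
    (∀ y → ¬ x ≤ y → f y ≡ g y) →
    (∀ y → x ≤ y → intervalSum x y f ≡ intervalSum x y g) →
    ∀ y → f y ≡ g y
  upset-determined x f g outside sums y = go y (<-wellFounded y)
    where
    top : ∀ {y} (h : Fin n → ℤ) → x ≤ y → guard (does (x ≤? y) ∧ does (y ≤? y)) (h y) ≡ h y
    top h x≤y = guard-cong (h _) (cong₂ _∧_ (dec-true (x ≤? _) x≤y) (dec-true (_ ≤? _) ≤-refl))

    go : ∀ y → Acc _<_ y → f y ≡ g y
    go y (acc below) with x ≤? y
    ... | no x≰y  = outside y x≰y
    ... | yes x≤y = trans (sym (top f x≤y)) (trans (Σ-agree-at n _ _ y lower (sums y x≤y)) (top g x≤y))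
      where
      lower : ∀ z → z ≢ y → guard (does (x ≤? z) ∧ does (z ≤? y)) (f z)
                          ≡ guard (does (x ≤? z) ∧ does (z ≤? y)) (g z)
      lower z z≢y with x ≤? z | z ≤? y
      ... | yes _ | yes z≤y = go z (below (z≤y , z≢y))
      ... | yes _ | no _    = refl
      ... | no _  | _       = refl

  möbius-rowSum : ∀ {μ} → IsMöbiusOf P μ → ∀ {x y} → x ≤ y → intervalSum x y (μ x) ≡ δ x y
  möbius-rowSum {μ} (diagonal , _ , sums) {x} {y} x≤y with x F.≟ y
  ... | yes refl = trans (intervalSum-singleton x (μ x)) (diagonal x)
  ... | no x≢y   = sums x y x≤y x≢y

  möbius-unique : ∀ {μ ν} → IsMöbiusOf P μ → IsMöbiusOf P ν → ∀ x y → μ x y ≡ ν x y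
  möbius-unique {μ} {ν} Mμ@(_ , μ-off , _) Mν@(_ , ν-off , _) x =
    upset-determined x (μ x) (ν x)
      (λ y x≰y → trans (μ-off x y x≰y) (sym (ν-off x y x≰y)))
      (λ y x≤y → trans (möbius-rowSum Mμ x≤y) (sym (möbius-rowSum Mν x≤y)))

module ConnectedSumOrder {n₀ n₁ : ℕ} (P₀ : FinPoset n₀) (P₁ : FinPoset n₁) (q₀ : Fin n₀) (q₁ : Fin n₁) where
  open ConnectedSum P₀ P₁ q₀ q₁ public
  open FinPoset P₀ using () renaming (_≤_ to _≤₀_; _≤?_ to _≤₀?_)
  open FinPoset P₁ using () renaming (_≤_ to _≤₁_; _≤?_ to _≤₁?_)
  module Möb₀ = PosetMöbius P₀
  module Möb₁ = PosetMöbius P₁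
  open Intervals _≼?_ public

  ι₀ : Fin n₀ → Fin (n₀ + n₁)
  ι₀ x = x ↑ˡ n₁

  ι₁ : Fin n₁ → Fin (n₀ + n₁)
  ι₁ y = n₀ ↑ʳ y

  split-ι₀ : ∀ x → splitAt n₀ (ι₀ x) ≡ inj₁ x
  split-ι₀ x = splitAt-↑ˡ n₀ x n₁

  split-ι₁ : ∀ y → splitAt n₀ (ι₁ y) ≡ inj₂ y
  split-ι₁ y = splitAt-↑ʳ n₀ n₁ y

  ι₀≢ι₁ : ∀ x y → ι₀ x ≢ ι₁ y
  ι₀≢ι₁ x y eq with trans (sym (split-ι₀ x)) (trans (cong (splitAt n₀) eq) (split-ι₁ y))
  ... | ()

  ≼-reindex : ∀ {a b a′ b′} → splitAt n₀ a ≡ a′ → splitAt n₀ b ≡ b′ → (a ≼ b) ⇔ (a′ ≼⊎ b′)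
  ≼-reindex refl refl = mk⇔ id id

  does-reindex : ∀ {a b a′ b′} → splitAt n₀ a ≡ a′ → splitAt n₀ b ≡ b′ → does (a ≼? b) ≡ does (a′ ≼⊎? b′)
  does-reindex refl refl = refl

  ι₀≼ι₀ : ∀ {x y} → (ι₀ x ≼ ι₀ y) ⇔ (x ≤₀ y)
  ι₀≼ι₀ = ≼-reindex (split-ι₀ _) (split-ι₀ _)

  ι₁≼ι₁ : ∀ {x y} → (ι₁ x ≼ ι₁ y) ⇔ (x ≤₁ y)
  ι₁≼ι₁ = ≼-reindex (split-ι₁ _) (split-ι₁ _)

  ι₀≼ι₁ : ∀ {x y} → (ι₀ x ≼ ι₁ y) ⇔ (x ≤₀ q₀ × q₁ ≤₁ y)
  ι₀≼ι₁ = ≼-reindex (split-ι₀ _) (split-ι₁ _)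

  ι₁⋠ι₀ : ∀ {x y} → ¬ ι₁ x ≼ ι₀ y
  ι₁⋠ι₀ = to (≼-reindex (split-ι₁ _) (split-ι₀ _))

  does-ι₀ι₀ : ∀ {x y} → does (ι₀ x ≼? ι₀ y) ≡ does (x ≤₀? y)
  does-ι₀ι₀ = does-reindex (split-ι₀ _) (split-ι₀ _)

  does-ι₁ι₁ : ∀ {x y} → does (ι₁ x ≼? ι₁ y) ≡ does (x ≤₁? y)
  does-ι₁ι₁ = does-reindex (split-ι₁ _) (split-ι₁ _)

  does-ι₀ι₁ : ∀ {x y} → does (ι₀ x ≼? ι₁ y) ≡ does (x ≤₀? q₀) ∧ does (q₁ ≤₁? y)
  does-ι₀ι₁ = does-reindex (split-ι₀ _) (split-ι₁ _)

  does-ι₁ι₀ : ∀ {x y} → does (ι₁ x ≼? ι₀ y) ≡ false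
  does-ι₁ι₀ = does-reindex (split-ι₁ _) (split-ι₀ _)

  intervalSum-ι₀ι₀ : ∀ x y (f : Fin (n₀ + n₁) → ℤ) → intervalSum (ι₀ x) (ι₀ y) f ≡ Möb₀.intervalSum x y (f ∘ ι₀)
  intervalSum-ι₀ι₀ x y f =
    trans (Σ-split n₀ n₁ _)
      (trans (cong₂ _⊕_ (Σ-cong n₀ (λ z → guard-cong (f (ι₀ z)) (cong₂ _∧_ does-ι₀ι₀ does-ι₀ι₀)))
                        (Σ-zero n₁ (λ z → guard-cong (f (ι₁ z)) (trans (cong (_ ∧_) does-ι₁ι₀) (∧-zeroʳ _)))))
             (ℤP.+-identityʳ _))

  intervalSum-ι₁ι₁ : ∀ x y (f : Fin (n₀ + n₁) → ℤ) → intervalSum (ι₁ x) (ι₁ y) f ≡ Möb₁.intervalSum x y (f ∘ ι₁)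
  intervalSum-ι₁ι₁ x y f =
    trans (Σ-split n₀ n₁ _)
      (trans (cong₂ _⊕_ (Σ-zero n₀ (λ z → guard-cong (f (ι₀ z)) (cong (_∧ _) does-ι₁ι₀)))
                        (Σ-cong n₁ (λ z → guard-cong (f (ι₁ z)) (cong₂ _∧_ does-ι₁ι₁ does-ι₁ι₁))))
             (ℤP.+-identityˡ _))

  intervalSum-ι₀ι₁ : ∀ {x y} → x ≤₀ q₀ → q₁ ≤₁ y → (f : Fin (n₀ + n₁) → ℤ) →
    intervalSum (ι₀ x) (ι₁ y) f ≡ Möb₀.intervalSum x q₀ (f ∘ ι₀) ⊕ Möb₁.intervalSum q₁ y (f ∘ ι₁)
  intervalSum-ι₀ι₁ {x} {y} x≤q₀ q₁≤y f =
    trans (Σ-split n₀ n₁ _)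
      (cong₂ _⊕_ (Σ-cong n₀ (λ z → guard-cong (f (ι₀ z)) (cong₂ _∧_ does-ι₀ι₀ below-q₀)))
                 (Σ-cong n₁ (λ z → guard-cong (f (ι₁ z)) (cong₂ _∧_ above-q₁ does-ι₁ι₁))))
    where
    below-q₀ : ∀ {z} → does (ι₀ z ≼? ι₁ y) ≡ does (z ≤₀? q₀)
    below-q₀ = trans does-ι₀ι₁ (trans (cong (_ ∧_) (dec-true (q₁ ≤₁? y) q₁≤y)) (∧-identityʳ _))
    above-q₁ : ∀ {z} → does (ι₀ x ≼? ι₁ z) ≡ does (q₁ ≤₁? z)
    above-q₁ = trans does-ι₀ι₁ (cong (_∧ _) (dec-true (x ≤₀? q₀) x≤q₀))

module ConnectedSumMöbius {n₀ n₁ : ℕ} (P₀ : FinPoset n₀) (P₁ : FinPoset n₁) (q₀ : Fin n₀) (q₁ : Fin n₁)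
  {μ₀ : Fin n₀ → Fin n₀ → ℤ} {μ₁ : Fin n₁ → Fin n₁ → ℤ} {μ : Fin (n₀ + n₁) → Fin (n₀ + n₁) → ℤ}
  (M₀ : IsMöbiusOf P₀ μ₀) (M₁ : IsMöbiusOf P₁ μ₁)
  (M : IsMöbius (ConnectedSum._≼_ P₀ P₁ q₀ q₁) (ConnectedSum._≼?_ P₀ P₁ q₀ q₁) μ) where
  open ConnectedSumOrder P₀ P₁ q₀ q₁
  open FinPoset P₀ using () renaming (_≤_ to _≤₀_; _≤?_ to _≤₀?_; isPartialOrder to ≤₀-po)
  open FinPoset P₁ using () renaming (_≤_ to _≤₁_; isPartialOrder to ≤₁-po)

  μ-diagonal : ∀ a → μ a a ≡ 1ℤ
  μ-diagonal = proj₁ M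

  μ-off : ∀ a b → ¬ a ≼ b → μ a b ≡ 0ℤ
  μ-off = proj₁ (proj₂ M)

  μ-sums : ∀ a b → a ≼ b → a ≢ b → intervalSum a b (μ a) ≡ 0ℤ
  μ-sums = proj₂ (proj₂ M)

  restriction₀-isMöbius : IsMöbiusOf P₀ (λ x y → μ (ι₀ x) (ι₀ y))
  restriction₀-isMöbius =
      (λ x → μ-diagonal (ι₀ x))
    , (λ x y x≰y → μ-off (ι₀ x) (ι₀ y) (x≰y ∘ to ι₀≼ι₀))
    , (λ x y x≤y x≢y → trans (sym (intervalSum-ι₀ι₀ x y (μ (ι₀ x))))
                             (μ-sums (ι₀ x) (ι₀ y) (from ι₀≼ι₀ x≤y) (x≢y ∘ ↑ˡ-injective n₁ x y)))

  restriction₁-isMöbius : IsMöbiusOf P₁ (λ x y → μ (ι₁ x) (ι₁ y))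
  restriction₁-isMöbius =
      (λ x → μ-diagonal (ι₁ x))
    , (λ x y x≰y → μ-off (ι₁ x) (ι₁ y) (x≰y ∘ to ι₁≼ι₁))
    , (λ x y x≤y x≢y → trans (sym (intervalSum-ι₁ι₁ x y (μ (ι₁ x))))
                             (μ-sums (ι₁ x) (ι₁ y) (from ι₁≼ι₁ x≤y) (x≢y ∘ ↑ʳ-injective n₀ x y)))

  μ-ι₀ι₀ : ∀ x y → μ (ι₀ x) (ι₀ y) ≡ μ₀ x y
  μ-ι₀ι₀ = Möb₀.möbius-unique restriction₀-isMöbius M₀

  μ-ι₁ι₁ : ∀ x y → μ (ι₁ x) (ι₁ y) ≡ μ₁ x y
  μ-ι₁ι₁ = Möb₁.möbius-unique restriction₁-isMöbius M₁

  μ-ι₁ι₀ : ∀ x y → μ (ι₁ x) (ι₀ y) ≡ 0ℤ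
  μ-ι₁ι₀ x y = μ-off (ι₁ x) (ι₀ y) ι₁⋠ι₀

  -- For x ≤ q₀ the row c ↦ μ(ι₀ x, ι₁ c) sums to −δ(q₀,x) over each [q₁,b]:
  -- the Möbius sum over [ι₀ x, ι₁ b] vanishes and its P₀-part is δ(x,q₀).
  crossRow-sum : ∀ {x b} → x ≤₀ q₀ → q₁ ≤₁ b → Möb₁.intervalSum q₁ b (μ (ι₀ x) ∘ ι₁) ≡ - δ q₀ x
  crossRow-sum {x} {b} x≤q₀ q₁≤b = inverseʳ-unique (δ q₀ x) _ (begin
    δ q₀ x ⊕ S₁
      ≡⟨ cong (_⊕ S₁) (trans (δ-sym q₀ x) (sym (Möb₀.möbius-rowSum M₀ x≤q₀))) ⟩
    Möb₀.intervalSum x q₀ (μ₀ x) ⊕ S₁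
      ≡⟨ cong (_⊕ S₁) (sym (Möb₀.intervalSum-cong x q₀ (μ-ι₀ι₀ x))) ⟩
    Möb₀.intervalSum x q₀ (μ (ι₀ x) ∘ ι₀) ⊕ S₁
      ≡⟨ sym (intervalSum-ι₀ι₁ x≤q₀ q₁≤b (μ (ι₀ x))) ⟩
    intervalSum (ι₀ x) (ι₁ b) (μ (ι₀ x))
      ≡⟨ μ-sums (ι₀ x) (ι₁ b) (from ι₀≼ι₁ (x≤q₀ , q₁≤b)) (ι₀≢ι₁ x b) ⟩
    0ℤ ∎)
    where
    open ≡-Reasoning
    S₁ : ℤ
    S₁ = Möb₁.intervalSum q₁ b (μ (ι₀ x) ∘ ι₁)

  scaledδ-off : ∀ A {c} → q₁ ≢ c → - (A * δ q₁ c) ≡ 0ℤ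
  scaledδ-off A q₁≢c = cong -_ (trans (cong (A *_) (δ-off q₁≢c)) (ℤP.*-zeroʳ A))

  μ-ι₀ι₁ : ∀ x y → μ (ι₀ x) (ι₁ y) ≡ - (δ q₀ x * δ q₁ y)
  μ-ι₀ι₁ x y with x ≤₀? q₀
  ... | no x≰q₀ =
    trans (μ-off (ι₀ x) (ι₁ y) (x≰q₀ ∘ proj₁ ∘ to ι₀≼ι₁))
          (cong (λ d → - (d * δ q₁ y)) (sym (δ-off (x≰q₀ ∘ IsPartialOrder.reflexive ≤₀-po ∘ sym))))
  ... | yes x≤q₀ = Möb₁.upset-determined q₁ (μ (ι₀ x) ∘ ι₁) g outside sums y
    where
    A : ℤ
    A = δ q₀ x
    g : Fin n₁ → ℤ
    g c = - (A * δ q₁ c)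

    outside : ∀ c → ¬ q₁ ≤₁ c → μ (ι₀ x) (ι₁ c) ≡ g c
    outside c q₁≰c =
      trans (μ-off (ι₀ x) (ι₁ c) (q₁≰c ∘ proj₂ ∘ to ι₀≼ι₁))
            (sym (scaledδ-off A (q₁≰c ∘ IsPartialOrder.reflexive ≤₁-po)))

    g-sum : ∀ {b} → q₁ ≤₁ b → Möb₁.intervalSum q₁ b g ≡ - A
    g-sum q₁≤b =
      trans (Möb₁.intervalSum-concentrated g q₁≤b (λ z _ _ z≢q₁ → scaledδ-off A (z≢q₁ ∘ sym)))
            (trans (cong (λ d → - (A * d)) (δ-self q₁)) (cong -_ (ℤP.*-identityʳ A)))

    sums : ∀ b → q₁ ≤₁ b → Möb₁.intervalSum q₁ b (μ (ι₀ x) ∘ ι₁) ≡ Möb₁.intervalSum q₁ b g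
    sums b q₁≤b = trans (crossRow-sum x≤q₀ q₁≤b) (sym (g-sum q₁≤b))

corollary1p6 : {n₀ n₁ : ℕ} (P₀ : FinPoset n₀) (P₁ : FinPoset n₁) (q₀ : Fin n₀) (q₁ : Fin n₁)
    (μ₀ : Fin n₀ → Fin n₀ → ℤ) (μ₁ : Fin n₁ → Fin n₁ → ℤ) (μ : Fin (n₀ + n₁) → Fin (n₀ + n₁) → ℤ) →
    IsMöbiusOf P₀ μ₀ → IsMöbiusOf P₁ μ₁ →
    IsMöbius (ConnectedSum._≼_ P₀ P₁ q₀ q₁) (ConnectedSum._≼?_ P₀ P₁ q₀ q₁) μ →
    ((x y : Fin n₀) → μ (x ↑ˡ n₁) (y ↑ˡ n₁) ≡ μ₀ x y)
    × ((x y : Fin n₁) → μ (n₀ ↑ʳ x) (n₀ ↑ʳ y) ≡ μ₁ x y)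
    × ((x : Fin n₀) (y : Fin n₁) → μ (x ↑ˡ n₁) (n₀ ↑ʳ y) ≡ - (δ q₀ x * δ q₁ y))
    × ((x : Fin n₁) (y : Fin n₀) → μ (n₀ ↑ʳ x) (y ↑ˡ n₁) ≡ 0ℤ)
corollary1p6 P₀ P₁ q₀ q₁ μ₀ μ₁ μ M₀ M₁ M = μ-ι₀ι₀ , μ-ι₁ι₁ , μ-ι₀ι₁ , μ-ι₁ι₀
  where open ConnectedSumMöbius P₀ P₁ q₀ q₁ M₀ M₁ M
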